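{- Let $n\ge0$ and $0\le r\le n$ be integers. The number of ordered trees with $n$ edges having exactly $r$ stumps is $1$ if $r=n$, is $0$ if $r=n-1$, and, if $r<n-1$, equals $$\sum_{i=1}^{n-r-1}\frac{i}{n-r-i}\binom{r+i}{r}\binom{2n-2r-2i}{n-r}.$$
   Context: An ordered tree is a rooted tree in which the children of each node are linearly ordered; its size is its number of edges. A stump is a leaf (childless node) whose parent is the root, i.e. a leaf at level one. $\binom{x}{j}=0$ when $j>x\ge0$. -}

module Defs where

open import Data.Nat using (ℕ; zero; suc; _+_; _*_; _∸_)
open import Data.Nat.Combinatorics using (_C_)
open import Data.Integer using (+_)
open import Data.List using (List; []; _∷_; map; foldr; applyUpTo)
open import Data.Rational using (ℚ; _/_; 0ℚ)
import Data.Rational as Q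
open import Data.Product using (Σ; _×_)
open import Relation.Binary.PropositionalEquality using (_≡_)

data OTree : Set where
  node : List OTree → OTree

mutual
  size : OTree → ℕ
  size (node cs) = sizeList cs

  -- each child contributes its connecting edge plus its own edges
  sizeList : List OTree → ℕ
  sizeList []       = 0
  sizeList (c ∷ cs) = suc (size c) + sizeList cs

isLeaf : OTree → ℕ
isLeaf (node [])      = 1
isLeaf (node (_ ∷ _)) = 0

stumps : OTree → ℕ
stumps (node cs) = foldr (λ c acc → isLeaf c + acc) 0 cs

TreesWith : ℕ → ℕ → Set
TreesWith n r = Σ OTree (λ t → (size t ≡ n) × (stumps t ≡ r))

-- a / d as a rational; the d = 0 branch is junk and never used below
divℕ : ℕ → ℕ → ℚ
divℕ a zero    = 0ℚ
divℕ a (suc d) = (+ a) / suc d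

sumℚ : List ℚ → ℚ
sumℚ = foldr Q._+_ 0ℚ

term : ℕ → ℕ → ℕ → ℚ
term n r i =
  divℕ i (n ∸ r ∸ i) Q.*
    divℕ (((r + i) C r) * ((2 * n ∸ 2 * r ∸ 2 * i) C (n ∸ r))) 1

formula : ℕ → ℕ → ℚ
formula n r = sumℚ (map (term n r) (applyUpTo suc (n ∸ r ∸ 1)))

-- A tree whose root has r stumps and i non-leaf children is determined by the order of these
-- r + i children, one of C(r+i, r) words, and by the forest of 2i trees obtained by splitting
-- every non-leaf child node (c ∷ cs) into c and node cs; that forest has n − r − 2i edges.
-- Forests of s trees with m edges are counted by the ballot numbers s/(2m+s)·C(2m+s, m), and
-- for s = 2i the product C(r+i, r)·(ballot number) is the i-th summand of the formula.
-- Peeling the root children, and then the forest trees, one at a time turns this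
-- decomposition into an explicit bijection with Fin k.
module Submission where

open import Defs
open import Data.Nat using (ℕ; suc; _≤_; _<_)
open import Data.Fin using (Fin)
open import Data.Product using (Σ; _×_)
open import Function.Bundles using (_↔_)
open import Relation.Binary.PropositionalEquality using (_≡_)
open import Data.Integer using (+_)
import Data.Rational as Q

import Data.Integer as ℤ
import Data.Integer.Properties as ℤₚ
open import Data.Empty using (⊥)
open import Data.Fin.Properties using (+↔⊎; 0↔⊥; 1↔⊤)
open import Data.List using (List; []; _∷_)
import Data.List as List
open import Data.Nat using (zero; _+_; _*_; _∸_; z≤n; s≤s; z<s; s<s)
open import Data.Nat.Combinatorics
  using (_C_; nCk+nC[k+1]≡[n+1]C[k+1]; nCk≡nC[n∸k]; k>n⇒nCk≡0; nCn≡1; nC1≡n)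
open import Data.Nat.Properties
open import Algebra.Properties.CommutativeSemigroup +-commutativeSemigroup
  using (x∙yz≈y∙xz; interchange)
open import Algebra.Properties.CommutativeSemigroup *-commutativeSemigroup
  using () renaming (x∙yz≈y∙xz to x*[y*z]≡y*[x*z])
open import Data.Nat.Tactic.RingSolver using (solve-∀)
open import Data.Product using (_,_)
open import Data.Rational using (ℚ)
import Data.Rational.Properties as Qₚ
import Data.Rational.Unnormalised as U
open import Data.Rational.Unnormalised using (mkℚᵘ; *≡*)
import Data.Rational.Unnormalised.Properties as Uₚ
open import Data.Sum using (_⊎_; inj₁; inj₂)
open import Data.Sum.Function.Propositional using (_⊎-↔_)
open import Data.Unit using (tt)
open import Data.Vec using (Vec; []; _∷_; sum; map)
open import Function.Base using (_∘_)
open import Function.Bundles using (mk↔ₛ′)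
open import Function.Properties.Inverse using (↔-trans; ↔-sym)
open import Relation.Binary.PropositionalEquality
  using (refl; sym; trans; cong; cong₂; subst; subst₂; module ≡-Reasoning)

pascal : ∀ n k → n C k + n C suc k ≡ suc n C suc k
pascal = nCk+nC[k+1]≡[n+1]C[k+1]

[k+1]*[n+1]C[k+1]≡[n+1]*nCk : ∀ n k → suc k * (suc n C suc k) ≡ suc n * (n C k)
[k+1]*[n+1]C[k+1]≡[n+1]*nCk n zero =
  trans (*-identityˡ (suc n C 1)) (trans (nC1≡n (suc n)) (sym (*-identityʳ (suc n))))
[k+1]*[n+1]C[k+1]≡[n+1]*nCk zero (suc k) =
  trans (cong (suc (suc k) *_) (k>n⇒nCk≡0 (s≤s (s≤s (z≤n {k}))))) (*-zeroʳ (suc (suc k)))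
[k+1]*[n+1]C[k+1]≡[n+1]*nCk (suc n) (suc k) = begin
  suc (suc k) * (suc (suc n) C suc (suc k))     ≡⟨ cong (suc (suc k) *_) (pascal (suc n) (suc k)) ⟨
  suc (suc k) * (X + Y)                         ≡⟨ regroup (suc k) X Y ⟩
  X + (suc k * X + suc (suc k) * Y)             ≡⟨ cong₂ (λ a b → X + (a + b))
                                                          ([k+1]*[n+1]C[k+1]≡[n+1]*nCk n k)
                                                          ([k+1]*[n+1]C[k+1]≡[n+1]*nCk n (suc k)) ⟩
  X + (suc n * (n C k) + suc n * (n C suc k))   ≡⟨ cong (_+_ X) (*-distribˡ-+ (suc n) (n C k) (n C suc k)) ⟨
  X + suc n * (n C k + n C suc k)               ≡⟨ cong (λ Z → X + suc n * Z) (pascal n k) ⟩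
  suc (suc n) * X                               ∎
  where
  open ≡-Reasoning
  X = suc n C suc k
  Y = suc n C suc (suc k)
  regroup : ∀ k X Y → suc k * (X + Y) ≡ X + (k * X + suc k * Y)
  regroup = solve-∀

Fin-+↔ : ∀ {a b} {A B C : Set} → Fin a ↔ A → Fin b ↔ B → C ↔ (A ⊎ B) → Fin (a + b) ↔ C
Fin-+↔ a↔A b↔B C↔A⊎B = ↔-trans +↔⊎ (↔-trans (a↔A ⊎-↔ b↔B) (↔-sym C↔A⊎B))

-- Forests and ballot numbers

weight : ∀ {s} → Vec OTree s → ℕ
weight F = sum (map size F)

Forest : ℕ → ℕ → Set
Forest s m = Σ (Vec OTree s) (λ F → weight F ≡ m)

-- Forests of suc s trees whose first tree is not a leaf: splitting it into c and node cs
-- leaves a forest of 2 + s trees with one edge less.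
ForestNodeFirst : ℕ → ℕ → Set
ForestNodeFirst s zero    = ⊥
ForestNodeFirst s (suc m) = Forest (2 + s) m

forests : ℕ → ℕ → ℕ
forestsNodeFirst : ℕ → ℕ → ℕ
forests zero    zero    = 1
forests zero    (suc m) = 0
forests (suc s) m       = forests s m + forestsNodeFirst s m
forestsNodeFirst s zero    = 0
forestsNodeFirst s (suc m) = forests (2 + s) m

weight-openFirst : ∀ {s} c cs (F : Vec OTree s) →
  weight (node (c ∷ cs) ∷ F) ≡ suc (weight (c ∷ node cs ∷ F))
weight-openFirst c cs F = cong suc (+-assoc (size c) (sizeList cs) (weight F))

Forest≡ : ∀ {s m} {F : Vec OTree s} {p q : weight F ≡ m} → _≡_ {A = Forest s m} (F , p) (F , q)
Forest≡ {p = p} {q} = cong (_ ,_) (≡-irrelevant p q)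

Forest-split : ∀ s m → Forest (suc s) m ↔ (Forest s m ⊎ ForestNodeFirst s m)
Forest-split s _ = mk↔ₛ′ split unsplit split-unsplit unsplit-split
  where
  split : ∀ {m} → Forest (suc s) m → Forest s m ⊎ ForestNodeFirst s m
  split (node [] ∷ F , w) = inj₁ (F , w)
  split {suc m} (node (c ∷ cs) ∷ F , w) =
    inj₂ (c ∷ node cs ∷ F , suc-injective (trans (sym (weight-openFirst c cs F)) w))
  unsplit : ∀ {m} → Forest s m ⊎ ForestNodeFirst s m → Forest (suc s) m
  unsplit (inj₁ (F , w)) = node [] ∷ F , w
  unsplit {suc m} (inj₂ (c ∷ node cs ∷ F , w)) =
    node (c ∷ cs) ∷ F , trans (weight-openFirst c cs F) (cong suc w)
  split-unsplit : ∀ {m} (y : Forest s m ⊎ ForestNodeFirst s m) → split (unsplit y) ≡ y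
  split-unsplit (inj₁ _) = refl
  split-unsplit {suc m} (inj₂ (_ ∷ node _ ∷ _ , _)) = cong inj₂ Forest≡
  unsplit-split : ∀ {m} (F : Forest (suc s) m) → unsplit (split F) ≡ F
  unsplit-split (node [] ∷ _ , _) = refl
  unsplit-split {suc m} (node (_ ∷ _) ∷ _ , _) = Forest≡

forests↔ : ∀ s m → Fin (forests s m) ↔ Forest s m
forestsNodeFirst↔ : ∀ s m → Fin (forestsNodeFirst s m) ↔ ForestNodeFirst s m
forests↔ zero zero =
  ↔-trans 1↔⊤ (mk↔ₛ′ (λ _ → [] , refl) (λ _ → tt) (λ { ([] , refl) → refl }) (λ _ → refl))
forests↔ zero (suc m) =
  ↔-trans 0↔⊥ (mk↔ₛ′ (λ ()) (λ { ([] , ()) }) (λ { ([] , ()) }) (λ ()))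
forests↔ (suc s) m = Fin-+↔ (forests↔ s m) (forestsNodeFirst↔ s m) (Forest-split s m)
forestsNodeFirst↔ s zero    = 0↔⊥
forestsNodeFirst↔ s (suc m) = forests↔ (2 + s) m

forests-leaves : ∀ s → forests s 0 ≡ 1
forests-leaves zero    = refl
forests-leaves (suc s) = trans (+-identityʳ (forests s 0)) (forests-leaves s)

-- Ballot b n k says b = C(n, k) − C(n, k+1), avoiding truncated subtraction.
Ballot : ℕ → ℕ → ℕ → Set
Ballot b n k = b + n C suc k ≡ n C k

forests-ballot : ∀ s m → Ballot (forests (suc s) m) (m + m + s) (m + s)
forests-ballot s zero =
  trans (cong₂ _+_ (forests-leaves (suc s)) (k>n⇒nCk≡0 (n<1+n s))) (sym (nCn≡1 s))
forests-ballot zero (suc m) = subst₂ (Ballot b) (sym top) (sym (+-identityʳ (suc m))) (begin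
  b + suc A C suc (suc m)           ≡⟨ cong (_+_ b) (pascal A (suc m)) ⟨
  b + (A C suc m + A C suc (suc m)) ≡⟨ x∙yz≈y∙xz b (A C suc m) (A C suc (suc m)) ⟩
  A C suc m + (b + A C suc (suc m)) ≡⟨ cong (_+_ (A C suc m)) (ih (forests-ballot 1 m)) ⟩
  A C suc m + A C suc m             ≡⟨ cong (_+ A C suc m) A-symmetric ⟨
  A C m + A C suc m                 ≡⟨ pascal A m ⟩
  suc A C suc m                     ∎)
  where
  open ≡-Reasoning
  b = forests 2 m
  A = suc (m + m)
  top : suc m + suc m + 0 ≡ suc A
  top = trans (+-identityʳ (suc m + suc m)) (cong suc (+-suc m m))
  ih : Ballot b (m + m + 1) (m + 1) → Ballot b A (suc m)
  ih = subst₂ (Ballot b) (+-comm (m + m) 1) (+-comm m 1)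
  A-symmetric : A C m ≡ A C suc m
  A-symmetric = trans (nCk≡nC[n∸k] (≤-trans (m≤m+n m m) (n≤1+n (m + m))))
                      (cong (A C_) (trans (+-∸-assoc 1 (m≤m+n m m)) (cong suc (m+n∸m≡n m m))))
forests-ballot (suc s) (suc m) = subst₂ (Ballot (b₁ + b₂)) (sym (top m s)) (sym (+-suc (suc m) s)) (begin
  (b₁ + b₂) + suc A C suc (suc k)           ≡⟨ cong (_+_ (b₁ + b₂)) (pascal A (suc k)) ⟨
  (b₁ + b₂) + (A C suc k + A C suc (suc k)) ≡⟨ interchange b₁ b₂ (A C suc k) (A C suc (suc k)) ⟩
  (b₁ + A C suc k) + (b₂ + A C suc (suc k)) ≡⟨ cong₂ _+_ (ih₁ (forests-ballot s (suc m)))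
                                                         (ih₂ (forests-ballot (2 + s) m)) ⟩
  A C k + A C suc k                         ≡⟨ pascal A k ⟩
  suc A C suc k                             ∎)
  where
  open ≡-Reasoning
  b₁ = forests (suc s) (suc m)
  b₂ = forests (3 + s) m
  k = suc (m + s)
  A = suc (suc (m + m + s))
  top : ∀ m s → suc m + suc m + suc s ≡ suc (suc (suc (m + m + s)))
  top = solve-∀
  top₁ : ∀ m s → suc m + suc m + s ≡ suc (suc (m + m + s))
  top₁ = solve-∀
  top₂ : ∀ m s → m + m + suc (suc s) ≡ suc (suc (m + m + s))
  top₂ = solve-∀
  ih₁ : Ballot b₁ (suc m + suc m + s) k → Ballot b₁ A k
  ih₁ = subst (λ n → Ballot b₁ n k) (top₁ m s)
  ih₂ : Ballot b₂ (m + m + suc (suc s)) (m + suc (suc s)) → Ballot b₂ A (suc k)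
  ih₂ = subst₂ (Ballot b₂) (top₂ m s) (trans (+-suc m (suc s)) (cong suc (+-suc m s)))

-- With N = 2m+s, X = C(N, m+s) and Y = C(N, m+s+1), the ballot identity is X = b + Y.
-- Absorption (m+s+1)·C(N+1, m+s+1) = (N+1)·X together with C(N+1, m+s+1) = X + Y
-- then forces (s+1)·Y = m·b, whence (N+1)·b = (s+1)·(X + Y).
forests-closed : ∀ s m → suc (m + m + s) * forests (suc s) m ≡ suc s * (suc (m + m + s) C suc (m + s))
forests-closed s m = begin
  suc N * b                    ≡⟨ expand s m b ⟩
  suc s * b + 2 * (m * b)      ≡⟨ cong (λ z → suc s * b + 2 * z) [s+1]*Y≡m*b ⟨
  suc s * b + 2 * (suc s * Y)  ≡⟨ collect s b Y ⟩
  suc s * ((b + Y) + Y)        ≡⟨ cong (suc s *_) b+Y+Y≡Z ⟩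
  suc s * Z                    ∎
  where
  open ≡-Reasoning
  N = m + m + s
  b = forests (suc s) m
  X = N C (m + s)
  Y = N C suc (m + s)
  Z = suc N C suc (m + s)
  b+Y+Y≡Z : (b + Y) + Y ≡ Z
  b+Y+Y≡Z = trans (cong (_+ Y) (forests-ballot s m)) (pascal N (m + s))
  absorb : suc (m + s) * ((b + Y) + Y) ≡ suc N * (b + Y)
  absorb = begin
    suc (m + s) * ((b + Y) + Y) ≡⟨ cong (suc (m + s) *_) b+Y+Y≡Z ⟩
    suc (m + s) * Z             ≡⟨ [k+1]*[n+1]C[k+1]≡[n+1]*nCk N (m + s) ⟩
    suc N * X                   ≡⟨ cong (suc N *_) (forests-ballot s m) ⟨
    suc N * (b + Y)             ∎
  expand : ∀ s m b → suc (m + m + s) * b ≡ suc s * b + 2 * (m * b)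
  expand = solve-∀
  collect : ∀ s b Y → suc s * b + 2 * (suc s * Y) ≡ suc s * ((b + Y) + Y)
  collect = solve-∀
  absorb-lhs : ∀ s m b Y → suc (m + s) * ((b + Y) + Y) ≡ (suc (m + s) * b + suc (m + m + s) * Y) + suc s * Y
  absorb-lhs = solve-∀
  absorb-rhs : ∀ s m b Y → suc (m + m + s) * (b + Y) ≡ (suc (m + s) * b + suc (m + m + s) * Y) + m * b
  absorb-rhs = solve-∀
  [s+1]*Y≡m*b : suc s * Y ≡ m * b
  [s+1]*Y≡m*b = +-cancelˡ-≡ (suc (m + s) * b + suc N * Y) _ _
    (trans (sym (absorb-lhs s m b Y)) (trans absorb (absorb-rhs s m b Y)))

forests-even-closed : ∀ j m →
  (suc j + m) * forests (suc j + suc j) m ≡ suc j * ((2 * (suc j + m)) C (suc j + (suc j + m)))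
forests-even-closed j m = *-cancelˡ-≡ _ _ 2 (begin
  2 * ((i + m) * forests (suc s) m)          ≡⟨ double j m (forests (suc s) m) ⟩
  suc (m + m + s) * forests (suc s) m        ≡⟨ forests-closed s m ⟩
  suc s * (suc (m + m + s) C suc (m + s))    ≡⟨ cong₂ (λ n k → suc s * (n C k)) (top j m) (bottom j m) ⟩
  suc s * ((2 * (i + m)) C (i + (i + m)))    ≡⟨ halve j _ ⟩
  2 * (i * ((2 * (i + m)) C (i + (i + m))))  ∎)
  where
  open ≡-Reasoning
  i = suc j
  s = j + suc j
  double : ∀ j m F → 2 * ((suc j + m) * F) ≡ suc (m + m + (j + suc j)) * F
  double = solve-∀
  top : ∀ j m → suc (m + m + (j + suc j)) ≡ 2 * (suc j + m)
  top = solve-∀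
  bottom : ∀ j m → suc (m + (j + suc j)) ≡ suc j + (suc j + m)
  bottom = solve-∀
  halve : ∀ j X → suc (j + suc j) * X ≡ 2 * (suc j * X)
  halve = solve-∀

-- openedForests s x i = forests (s + 2i) (x − 2i), and 0 when x < 2i: the forests left
-- after i non-leaf root children have been split, each costing two edges.
openedForests : ℕ → ℕ → ℕ → ℕ
openedForests s x             zero    = forests s x
openedForests s zero          (suc i) = 0
openedForests s (suc zero)    (suc i) = 0
openedForests s (suc (suc x)) (suc i) = openedForests (2 + s) x i

openedForests-forests : ∀ s i m → openedForests s (i + (i + m)) i ≡ forests (i + i + s) m
openedForests-forests s zero    m = refl
openedForests-forests s (suc i) m = begin
  openedForests s (suc i + (suc i + m)) (suc i)  ≡⟨ cong (λ x → openedForests s x (suc i)) (shift i m) ⟩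
  openedForests (2 + s) (i + (i + m)) i          ≡⟨ openedForests-forests (2 + s) i m ⟩
  forests (i + i + (2 + s)) m                    ≡⟨ cong (λ t → forests t m) (regroup i s) ⟨
  forests (suc i + suc i + s) m                  ∎
  where
  open ≡-Reasoning
  shift : ∀ i m → suc i + (suc i + m) ≡ suc (suc (i + (i + m)))
  shift = solve-∀
  regroup : ∀ i s → suc i + suc i + s ≡ i + i + suc (suc s)
  regroup = solve-∀

openedForests-vanishes : ∀ s x i → x < i + i → openedForests s x i ≡ 0
openedForests-vanishes s zero          (suc i) _ = refl
openedForests-vanishes s (suc zero)    (suc i) _ = refl
openedForests-vanishes s (suc (suc x)) (suc i) (s≤s x+2≤i+1+i) =
  openedForests-vanishes (2 + s) x i (≤-pred (subst (suc (suc x) ≤_) (+-suc i i) x+2≤i+1+i))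

openedForests-closed : ∀ i e → e * openedForests 0 (i + e) i ≡ i * ((2 * e) C (i + e))
openedForests-closed zero    zero    = refl
openedForests-closed zero    (suc e) = *-zeroʳ (suc e)
openedForests-closed (suc j) e with ≤-<-connex (suc j) e
... | inj₁ i≤e with m≤n⇒∃[o]m+o≡n i≤e
...   | m , refl = trans (cong ((suc j + m) *_) opened≡forests) (forests-even-closed j m)
  where
  opened≡forests : openedForests 0 (suc j + (suc j + m)) (suc j) ≡ forests (suc j + suc j) m
  opened≡forests = trans (openedForests-forests 0 (suc j) m)
                         (cong (λ t → forests t m) (+-identityʳ (suc j + suc j)))
openedForests-closed (suc j) e | inj₂ e<i = begin
  e * openedForests 0 (i + e) i   ≡⟨ cong (e *_) (openedForests-vanishes 0 (i + e) i (+-monoʳ-< i e<i)) ⟩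
  e * 0                           ≡⟨ *-zeroʳ e ⟩
  0                               ≡⟨ *-zeroʳ i ⟨
  i * 0                           ≡⟨ cong (i *_) (k>n⇒nCk≡0 2e<i+e) ⟨
  i * ((2 * e) C (i + e))         ∎
  where
  open ≡-Reasoning
  i = suc j
  2e<i+e : 2 * e < i + e
  2e<i+e = subst (_< i + e) (cong (_+_ e) (sym (+-identityʳ e))) (+-monoˡ-< e e<i)

sumBelow : ℕ → (ℕ → ℕ) → ℕ
sumBelow zero    f = 0
sumBelow (suc K) f = f 0 + sumBelow K (λ i → f (suc i))

sumBelow-cong : ∀ K {f g : ℕ → ℕ} → (∀ i → f i ≡ g i) → sumBelow K f ≡ sumBelow K g
sumBelow-cong zero    f≗g = refl
sumBelow-cong (suc K) f≗g = cong₂ _+_ (f≗g 0) (sumBelow-cong K (λ i → f≗g (suc i)))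

sumBelow-distrib-+ : ∀ K (f g : ℕ → ℕ) → sumBelow K (λ i → f i + g i) ≡ sumBelow K f + sumBelow K g
sumBelow-distrib-+ zero    f g = refl
sumBelow-distrib-+ (suc K) f g =
  trans (cong (_+_ (f 0 + g 0)) (sumBelow-distrib-+ K _ _)) (interchange (f 0) (g 0) _ _)

sumBelow-zero : ∀ K {f : ℕ → ℕ} → (∀ i → f i ≡ 0) → sumBelow K f ≡ 0
sumBelow-zero zero    f≗0 = refl
sumBelow-zero (suc K) f≗0 = cong₂ _+_ (f≗0 0) (sumBelow-zero K (λ i → f≗0 (suc i)))

-- Partially opened trees

-- The root children R still to be read and the forest F of the s trees split off the non-leaf
-- root children already read; x is the excess of the remaining edges over the r stumps in R.
Config : ℕ → ℕ → ℕ → Set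
Config s r x = Σ (List OTree × Vec OTree s)
  (λ (R , F) → (sizeList R + weight F ≡ r + x) × (stumps (node R) ≡ r))

-- The root list does not start with a non-leaf: for r = 0 it is empty and only the forest
-- remains, otherwise it starts with a stump.
LeafFirst : ℕ → ℕ → ℕ → Set
LeafFirst s zero    x = Forest s x
LeafFirst s (suc r) x = Config s r x

NodeFirst : ℕ → ℕ → ℕ → Set
NodeFirst s r (suc (suc x)) = Config (2 + s) r x
NodeFirst s r _             = ⊥

configs : ℕ → ℕ → ℕ → ℕ
configsNodeFirst : ℕ → ℕ → ℕ → ℕ
configs s zero    x = forests s x + configsNodeFirst s zero x
configs s (suc r) x = configs s r x + configsNodeFirst s (suc r) x
configsNodeFirst s r (suc (suc x)) = configs (2 + s) r x
configsNodeFirst s r _             = 0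

stumps≤sizeList : ∀ R → stumps (node R) ≤ sizeList R
stumps≤sizeList []                 = z≤n
stumps≤sizeList (node [] ∷ R)      = s≤s (stumps≤sizeList R)
stumps≤sizeList (node (_ ∷ _) ∷ R) = m≤n⇒m≤o+n _ (stumps≤sizeList R)

sizeList-openFirst : ∀ {s} c cs R (F : Vec OTree s) →
  sizeList (node (c ∷ cs) ∷ R) + weight F ≡ suc (suc (sizeList R + weight (c ∷ node cs ∷ F)))
sizeList-openFirst c cs R F = regroup (size c) (sizeList cs) (sizeList R) (weight F)
  where
  regroup : ∀ a b R F → suc (suc (a + b + R)) + F ≡ suc (suc (R + (a + (b + F))))
  regroup = solve-∀

+-suc-suc : ∀ r x → r + suc (suc x) ≡ suc (suc (r + x))
+-suc-suc r x = trans (+-suc r (suc x)) (cong suc (+-suc r x))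

nodeFirst-excess : ∀ {s r x} c cs R (F : Vec OTree s) →
  sizeList (node (c ∷ cs) ∷ R) + weight F ≡ r + x → stumps (node R) ≡ r → 2 ≤ x
nodeFirst-excess {r = r} {x} c cs R F w refl = +-cancelˡ-≤ r 2 x (begin
  r + 2                                    ≤⟨ +-monoˡ-≤ 2 (stumps≤sizeList R) ⟩
  sizeList R + 2                           ≤⟨ m≤m+n (sizeList R + 2) W ⟩
  sizeList R + 2 + W                       ≡⟨ trans (+-assoc (sizeList R) 2 W) (+-suc-suc (sizeList R) W) ⟩
  suc (suc (sizeList R + W))               ≡⟨ sizeList-openFirst c cs R F ⟨
  sizeList (node (c ∷ cs) ∷ R) + weight F  ≡⟨ w ⟩
  r + x                                    ∎)
  where
  open ≤-Reasoning
  W = weight (c ∷ node cs ∷ F)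

≡×≡-irrelevant : {a b c d : ℕ} (p q : (a ≡ b) × (c ≡ d)) → p ≡ q
≡×≡-irrelevant (p₁ , p₂) (q₁ , q₂) = cong₂ _,_ (≡-irrelevant p₁ q₁) (≡-irrelevant p₂ q₂)

Config≡ : ∀ {s r x} {RF : List OTree × Vec OTree s} {p q} → _≡_ {A = Config s r x} (RF , p) (RF , q)
Config≡ {p = p} {q} = cong (_ ,_) (≡×≡-irrelevant p q)

Config-split : ∀ s r x → Config s r x ↔ (LeafFirst s r x ⊎ NodeFirst s r x)
Config-split s _ _ = mk↔ₛ′ split unsplit split-unsplit unsplit-split
  where
  openFirst : ∀ {r x} c cs R (F : Vec OTree s) →
    sizeList (node (c ∷ cs) ∷ R) + weight F ≡ r + x → stumps (node R) ≡ r → NodeFirst s r x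
  openFirst {x = zero}     c cs R F w st with () ← nodeFirst-excess c cs R F w st
  openFirst {x = suc zero} c cs R F w st with s≤s () ← nodeFirst-excess c cs R F w st
  openFirst {r} {suc (suc x)} c cs R F w st =
    (R , c ∷ node cs ∷ F) ,
    suc-injective (suc-injective (trans (sym (sizeList-openFirst c cs R F)) (trans w (+-suc-suc r x)))) , st
  closeFirst : ∀ {r x} → NodeFirst s r x → Config s r x
  closeFirst {r} {suc (suc x)} ((R , c ∷ node cs ∷ F) , w , st) =
    (node (c ∷ cs) ∷ R , F) ,
    trans (sizeList-openFirst c cs R F) (trans (cong (suc ∘ suc) w) (sym (+-suc-suc r x))) , st
  -- The non-leaf clauses come first, so that split and unsplit compute on them without
  -- a case split on r.
  split : ∀ {r x} → Config s r x → LeafFirst s r x ⊎ NodeFirst s r x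
  split ((node (c ∷ cs) ∷ R , F) , w , st) = inj₂ (openFirst c cs R F w st)
  split {zero}  (([] , F) , w , _)  = inj₁ (F , w)
  split {suc r} (([] , F) , _ , ())
  split {zero}  ((node [] ∷ R , F) , _ , ())
  split {suc r} ((node [] ∷ R , F) , w , st) = inj₁ ((R , F) , suc-injective w , suc-injective st)
  unsplit : ∀ {r x} → LeafFirst s r x ⊎ NodeFirst s r x → Config s r x
  unsplit (inj₂ y) = closeFirst y
  unsplit {zero}  (inj₁ (F , w)) = ([] , F) , w , refl
  unsplit {suc r} (inj₁ ((R , F) , w , st)) = (node [] ∷ R , F) , cong suc w , cong suc st
  split-unsplit : ∀ {r x} (y : LeafFirst s r x ⊎ NodeFirst s r x) → split (unsplit y) ≡ y
  split-unsplit {x = suc (suc x)} (inj₂ ((_ , _ ∷ node _ ∷ _) , _)) = cong inj₂ Config≡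
  split-unsplit {zero}  (inj₁ _) = refl
  split-unsplit {suc r} (inj₁ _) = cong inj₁ Config≡
  unsplit-split : ∀ {r x} (z : Config s r x) → unsplit (split z) ≡ z
  unsplit-split {x = zero}     ((node (c ∷ cs) ∷ R , F) , w , st) with () ← nodeFirst-excess c cs R F w st
  unsplit-split {x = suc zero} ((node (c ∷ cs) ∷ R , F) , w , st) with s≤s () ← nodeFirst-excess c cs R F w st
  unsplit-split {x = suc (suc x)} ((node (_ ∷ _) ∷ _ , _) , _) = Config≡
  unsplit-split {zero}  (([] , _) , _ , refl) = refl
  unsplit-split {suc r} ((node [] ∷ _ , _) , _) = Config≡

configs↔ : ∀ s r x → Fin (configs s r x) ↔ Config s r x
configsNodeFirst↔ : ∀ s r x → Fin (configsNodeFirst s r x) ↔ NodeFirst s r x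
configs↔ s zero    x = Fin-+↔ (forests↔ s x) (configsNodeFirst↔ s zero x) (Config-split s zero x)
configs↔ s (suc r) x = Fin-+↔ (configs↔ s r x) (configsNodeFirst↔ s (suc r) x) (Config-split s (suc r) x)
configsNodeFirst↔ s r zero          = 0↔⊥
configsNodeFirst↔ s r (suc zero)    = 0↔⊥
configsNodeFirst↔ s r (suc (suc x)) = configs↔ (2 + s) r x

TreesWith↔Config : ∀ r x → TreesWith (r + x) r ↔ Config 0 r x
TreesWith↔Config r x = mk↔ₛ′ to from to-from from-to
  where
  to : TreesWith (r + x) r → Config 0 r x
  to (node R , w , st) = (R , []) , trans (+-identityʳ (sizeList R)) w , st
  from : Config 0 r x → TreesWith (r + x) r
  from ((R , []) , w , st) = node R , trans (sym (+-identityʳ (sizeList R))) w , st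
  to-from : ∀ c → to (from c) ≡ c
  to-from ((_ , []) , _) = Config≡
  from-to : ∀ t → from (to t) ≡ t
  from-to (node R , p) = cong (node R ,_) (≡×≡-irrelevant _ p)

configs-closed : ∀ s r x K → x < K + K →
  configs s r x ≡ sumBelow K (λ i → ((r + i) C r) * openedForests s x i)
configsNodeFirst-closed : ∀ s r x K → x < suc K + suc K →
  configsNodeFirst s r x ≡ sumBelow K (λ i → ((r + i) C r) * openedForests s x (suc i))
configs-closed s zero x (suc K) x<2K =
  cong₂ _+_ (sym (*-identityˡ (forests s x))) (configsNodeFirst-closed s zero x K x<2K)
configs-closed s (suc r) x (suc K) x<2K = begin
  configs s r x + configsNodeFirst s (suc r) x
    ≡⟨ cong₂ _+_ (configs-closed s r x (suc K) x<2K) (configsNodeFirst-closed s (suc r) x K x<2K) ⟩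
  sumBelow (suc K) (λ i → ((r + i) C r) * g i) + sumBelow K (λ i → ((suc r + i) C suc r) * g (suc i))
    ≡⟨ cong (_+_ (sumBelow (suc K) (λ i → ((r + i) C r) * g i))) shifted ⟨
  sumBelow (suc K) (λ i → ((r + i) C r) * g i) + sumBelow (suc K) (λ i → ((r + i) C suc r) * g i)
    ≡⟨ sumBelow-distrib-+ (suc K) (λ i → ((r + i) C r) * g i) (λ i → ((r + i) C suc r) * g i) ⟨
  sumBelow (suc K) (λ i → ((r + i) C r) * g i + ((r + i) C suc r) * g i)
    ≡⟨ sumBelow-cong (suc K) (λ i → trans (sym (*-distribʳ-+ (g i) ((r + i) C r) ((r + i) C suc r)))
                                          (cong (_* g i) (pascal (r + i) r))) ⟩
  sumBelow (suc K) (λ i → ((suc r + i) C suc r) * g i) ∎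
  where
  open ≡-Reasoning
  g = openedForests s x
  shifted : sumBelow (suc K) (λ i → ((r + i) C suc r) * g i)
          ≡ sumBelow K (λ i → ((suc r + i) C suc r) * g (suc i))
  shifted = cong₂ _+_
    (trans (cong (λ n → (n C suc r) * g 0) (+-identityʳ r)) (cong (_* g 0) (k>n⇒nCk≡0 (n<1+n r))))
    (sumBelow-cong K (λ i → cong (λ n → (n C suc r) * g (suc i)) (+-suc r i)))
configsNodeFirst-closed s r zero          K _ = sym (sumBelow-zero K (λ i → *-zeroʳ ((r + i) C r)))
configsNodeFirst-closed s r (suc zero)    K _ = sym (sumBelow-zero K (λ i → *-zeroʳ ((r + i) C r)))
configsNodeFirst-closed s r (suc (suc x)) K x+2<2K+2 =
  configs-closed (2 + s) r x K (≤-pred (≤-pred (subst (3 + x ≤_) (cong suc (+-suc K K)) x+2<2K+2)))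

configs-small-excess : ∀ s r x → x < 2 → configs s r x ≡ forests s x
configs-small-excess s zero    zero          _   = +-identityʳ (forests s 0)
configs-small-excess s zero    (suc zero)    _   = +-identityʳ (forests s 1)
configs-small-excess s (suc r) zero          x<2 =
  trans (+-identityʳ (configs s r 0)) (configs-small-excess s r 0 x<2)
configs-small-excess s (suc r) (suc zero)    x<2 =
  trans (+-identityʳ (configs s r 1)) (configs-small-excess s r 1 x<2)
configs-small-excess s r       (suc (suc x)) (s≤s (s≤s ()))

toℚᵘ-/ : ∀ a d → Q.toℚᵘ (+ a Q./ suc d) U.≃ mkℚᵘ (+ a) d
toℚᵘ-/ a d = Qₚ.toℚᵘ-fromℚᵘ (mkℚᵘ (+ a) d)

/1-homo-+ : ∀ a b → (+ a Q./ 1) Q.+ (+ b Q./ 1) ≡ + (a + b) Q./ 1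
/1-homo-+ a b = Qₚ.toℚᵘ-injective (begin
  Q.toℚᵘ ((+ a Q./ 1) Q.+ (+ b Q./ 1))       ≈⟨ Qₚ.toℚᵘ-homo-+ (+ a Q./ 1) (+ b Q./ 1) ⟩
  Q.toℚᵘ (+ a Q./ 1) U.+ Q.toℚᵘ (+ b Q./ 1)  ≈⟨ Uₚ.+-cong (toℚᵘ-/ a 0) (toℚᵘ-/ b 0) ⟩
  mkℚᵘ (+ a) 0 U.+ mkℚᵘ (+ b) 0              ≈⟨ *≡* (cong (ℤ._* ℤ.1ℤ) numerators) ⟩
  mkℚᵘ (+ (a + b)) 0                         ≈⟨ toℚᵘ-/ (a + b) 0 ⟨
  Q.toℚᵘ (+ (a + b) Q./ 1)                   ∎)
  where
  open Uₚ.≃-Reasoning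
  numerators : + a ℤ.* ℤ.1ℤ ℤ.+ + b ℤ.* ℤ.1ℤ ≡ + (a + b)
  numerators = trans (cong₂ ℤ._+_ (ℤₚ.*-identityʳ (+ a)) (ℤₚ.*-identityʳ (+ b))) (sym (ℤₚ.pos-+ a b))

[a/d]*[c/1]≡g/1 : ∀ a d c g → suc d * g ≡ a * c → (+ a Q./ suc d) Q.* (+ c Q./ 1) ≡ + g Q./ 1
[a/d]*[c/1]≡g/1 a d c g eq = Qₚ.toℚᵘ-injective (begin
  Q.toℚᵘ ((+ a Q./ suc d) Q.* (+ c Q./ 1))       ≈⟨ Qₚ.toℚᵘ-homo-* (+ a Q./ suc d) (+ c Q./ 1) ⟩
  Q.toℚᵘ (+ a Q./ suc d) U.* Q.toℚᵘ (+ c Q./ 1)  ≈⟨ Uₚ.*-cong (toℚᵘ-/ a d) (toℚᵘ-/ c 0) ⟩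
  mkℚᵘ (+ a) d U.* mkℚᵘ (+ c) 0                  ≈⟨ *≡* cross ⟩
  mkℚᵘ (+ g) 0                                   ≈⟨ toℚᵘ-/ g 0 ⟨
  Q.toℚᵘ (+ g Q./ 1)                             ∎)
  where
  open Uₚ.≃-Reasoning
  cross : (+ a ℤ.* + c) ℤ.* ℤ.1ℤ ≡ + g ℤ.* (+ suc d ℤ.* ℤ.1ℤ)
  cross = trans (ℤₚ.*-identityʳ (+ a ℤ.* + c))
         (trans (sym (ℤₚ.pos-* a c))
         (trans (cong +_ (sym eq))
         (trans (ℤₚ.pos-* (suc d) g)
         (trans (ℤₚ.*-comm (+ suc d) (+ g))
                (cong (+ g ℤ.*_) (sym (ℤₚ.*-identityʳ (+ suc d))))))))

sumℚ-applyUpTo : ∀ K (f : ℕ → ℕ) (h : ℕ → ℚ) (g : ℕ → ℕ) →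
  (∀ i → i < K → h (f i) ≡ + g i Q./ 1) → sumℚ (List.map h (List.applyUpTo f K)) ≡ + sumBelow K g Q./ 1
sumℚ-applyUpTo zero    f h g h∘f≗g = refl
sumℚ-applyUpTo (suc K) f h g h∘f≗g = trans
  (cong₂ Q._+_ (h∘f≗g 0 z<s)
     (sumℚ-applyUpTo K (λ i → f (suc i)) h (λ i → g (suc i)) (λ i i<K → h∘f≗g (suc i) (s<s i<K))))
  (/1-homo-+ (g 0) (sumBelow K (λ i → g (suc i))))

m+[n+o]∸m∸n≡o : ∀ m n o → m + (n + o) ∸ m ∸ n ≡ o
m+[n+o]∸m∸n≡o m n o = trans (cong (_∸ n) (m+n∸m≡n m (n + o))) (m+n∸m≡n n o)

term-value : ∀ r i e → term (r + (i + suc e)) r i ≡ + (((r + i) C r) * openedForests 0 (i + suc e) i) Q./ 1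
term-value r i e = begin
  term n r i
    ≡⟨ cong₂ (λ d b → divℕ i d Q.* divℕ (c * b) 1) (m+[n+o]∸m∸n≡o r i (suc e))
             (cong₂ _C_ doubled (m+n∸m≡n r (i + suc e))) ⟩
  (+ i Q./ suc e) Q.* (+ (c * ((2 * suc e) C (i + suc e))) Q./ 1)
    ≡⟨ [a/d]*[c/1]≡g/1 i e _ _ (begin
         suc e * (c * γ)                        ≡⟨ x*[y*z]≡y*[x*z] (suc e) c γ ⟩
         c * (suc e * γ)                        ≡⟨ cong (c *_) (openedForests-closed i (suc e)) ⟩
         c * (i * ((2 * suc e) C (i + suc e)))  ≡⟨ x*[y*z]≡y*[x*z] c i _ ⟩
         i * (c * ((2 * suc e) C (i + suc e)))  ∎) ⟩
  + (c * γ) Q./ 1 ∎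
  where
  open ≡-Reasoning
  n = r + (i + suc e)
  c = (r + i) C r
  γ = openedForests 0 (i + suc e) i
  doubled : 2 * n ∸ 2 * r ∸ 2 * i ≡ 2 * suc e
  doubled = begin
    2 * n ∸ 2 * r ∸ 2 * i    ≡⟨ cong (_∸ 2 * i) (*-distribˡ-∸ 2 n r) ⟨
    2 * (n ∸ r) ∸ 2 * i      ≡⟨ *-distribˡ-∸ 2 (n ∸ r) i ⟨
    2 * (n ∸ r ∸ i)          ≡⟨ cong (2 *_) (m+[n+o]∸m∸n≡o r i (suc e)) ⟩
    2 * suc e                ∎

-- Take K = x in the closed form; its i = 0 summand vanishes since forests 0 x = 0.
configs-formula : ∀ r x → 2 ≤ x → + configs 0 r x Q./ 1 ≡ formula (r + x) r
configs-formula r (suc zero) (s≤s ())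
configs-formula r x@(suc (suc k)) _ = begin
  + configs 0 r x Q./ 1
    ≡⟨ cong (λ c → + c Q./ 1) (trans (configs-closed 0 r x x (m<m+n x z<s))
                                      (cong (_+ sumBelow (suc k) g) (*-zeroʳ ((r + 0) C r)))) ⟩
  + sumBelow (suc k) g Q./ 1
    ≡⟨ sumℚ-applyUpTo (suc k) suc (term (r + x) r) g term-suc ⟨
  sumℚ (List.map (term (r + x) r) (List.applyUpTo suc (suc k)))
    ≡⟨ cong (λ K → sumℚ (List.map (term (r + x) r) (List.applyUpTo suc K))) summands ⟨
  formula (r + x) r ∎
  where
  open ≡-Reasoning
  g : ℕ → ℕ
  g i = ((r + suc i) C r) * openedForests 0 x (suc i)
  summands : r + x ∸ r ∸ 1 ≡ suc k
  summands = cong (_∸ 1) (m+n∸m≡n r x)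
  term-suc : ∀ i → i < suc k → term (r + x) r (suc i) ≡ + g i Q./ 1
  term-suc i (s≤s i≤k) =
    subst (λ y → term (r + y) r (suc i) ≡ + (((r + suc i) C r) * openedForests 0 y (suc i)) Q./ 1)
          (cong suc (trans (+-suc i (k ∸ i)) (cong suc (m+[n∸m]≡n i≤k))))
          (term-value r (suc i) (k ∸ i))

proposition10 : (n r : ℕ) → r ≤ n →
    Σ ℕ (λ k → (Fin k ↔ TreesWith n r)
      × ((r ≡ n → k ≡ 1)
      × ((suc r ≡ n → k ≡ 0)
      × (suc r < n → (+ k) Q./ 1 ≡ formula n r))))
proposition10 n r r≤n with m≤n⇒∃[o]m+o≡n r≤n
... | x , refl =
  configs 0 r x , ↔-trans (configs↔ 0 r x) (↔-sym (TreesWith↔Config r x)) , no-excess , unit-excess ,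
  λ r+1<n → configs-formula r x (+-cancelˡ-≤ r 2 x (subst (_≤ r + x) (+-comm 2 r) r+1<n))
  where
  no-excess : r ≡ r + x → configs 0 r x ≡ 1
  no-excess r≡n = subst (λ y → configs 0 r y ≡ 1) (+-cancelˡ-≡ r 0 x (trans (+-identityʳ r) r≡n))
                        (configs-small-excess 0 r 0 z<s)
  unit-excess : suc r ≡ r + x → configs 0 r x ≡ 0
  unit-excess r+1≡n = subst (λ y → configs 0 r y ≡ 0) (+-cancelˡ-≡ r 1 x (trans (+-comm r 1) r+1≡n))
                            (configs-small-excess 0 r 1 (s<s z<s))
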